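{- Let $G$ be a graph on $n$ vertices and let $X\subseteq V(G)$. (1) If $X=\{x\}$, then $x$ is contained in at most $\frac{r^2b^2}{16}\le\left(\frac{n-1}{4}\right)^4$ vertex sets of size $5$ inducing a $5$-cycle, where $r$ is the number of neighbors and $b$ the number of non-neighbors of $x$ in $G$. (2) If $|X|=2$, then $X$ is contained in at most $\left(\frac{n-2}{3}\right)^3$ vertex sets of size $5$ inducing a $5$-cycle. (3) If $|X|=3$, then $X$ is contained in at most $\left(\frac{n-3}{2}\right)^2$ vertex sets of size $5$ inducing a $5$-cycle.
   Context: All graphs are finite and simple. -}

module Defs where

open import Data.Nat using (ℕ; zero; suc; _+_; _*_; _∸_; _^_; _≤_)
open import Data.Bool using (Bool; true; false; not; _∧_)
open import Data.Fin using (Fin; zero; suc; _≟_)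
open import Data.Fin.Subset using (Subset; _∈_; _⊆_; ∣_∣)
open import Data.List using (List; length; filter; allFin)
open import Data.List.Relation.Unary.All using (All)
open import Data.List.Relation.Unary.Unique.Propositional using (Unique)
open import Data.Product using (Σ; ∃; _×_)
open import Data.Sum using (_⊎_)
open import Function.Definitions using (Injective)
open import Relation.Binary.PropositionalEquality using (_≡_)
open import Relation.Nullary.Decidable using (⌊_⌋; ¬?)
open import Function.Bundles using (_⇔_)

record Graph (n : ℕ) : Set where
  field
    E     : Fin n → Fin n → Bool
    sym   : ∀ u v → E u v ≡ E v u
    irrfl : ∀ v → E v v ≡ false
open Graph public

nbrs : ∀ {n} → Graph n → Fin n → ℕ
nbrs {n} G x = length (filter (λ v → E G x v Data.Bool.≟ true) (allFin n))

nonNbrs : ∀ {n} → Graph n → Fin n → ℕ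
nonNbrs {n} G x =
  length (filter (λ v → (¬? (x ≟ v)) Relation.Nullary.Decidable.×-dec (E G x v Data.Bool.≟ false)) (allFin n))

suc5 : Fin 5 → Fin 5
suc5 zero = suc zero
suc5 (suc zero) = suc (suc zero)
suc5 (suc (suc zero)) = suc (suc (suc zero))
suc5 (suc (suc (suc zero))) = suc (suc (suc (suc zero)))
suc5 (suc (suc (suc (suc zero)))) = zero

C5Adj : Fin 5 → Fin 5 → Set
C5Adj i j = (j ≡ suc5 i) ⊎ (i ≡ suc5 j)

InducesC5 : ∀ {n} → Graph n → Subset n → Set
InducesC5 {n} G S =
  (∣ S ∣ ≡ 5) ×
  Σ (Fin 5 → Fin n) λ v →
      Injective _≡_ _≡_ v
    × (∀ u → (u ∈ S) ⇔ (∃ λ i → v i ≡ u))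
    × (∀ i j → (E G (v i) (v j) ≡ true) ⇔ C5Adj i j)

-- A family of pairwise distinct vertex sets S, each satisfying P S
-- and inducing a 5-cycle (an explicit listing of some such sets).
C5Family : ∀ {n} → Graph n → (Subset n → Set) → List (Subset n) → Set
C5Family G P L = Unique L × All (λ S → P S × InducesC5 G S) L

{-# OPTIONS --safe #-}
module Submission where

-- A 5-cycle S through the fixed vertices is determined by its remaining vertices, so S can be encoded
-- injectively by a tuple of vertices and L counted by counting admissible tuples.
--
-- If |X| = 3 (resp. 2), the adjacency profiles towards X of the two (three) other vertices of S are
-- determined by G[X] and pairwise distinct.  These vertices therefore lie in disjoint classes of vertices
-- outside X, |L| is at most the product of the class sizes, and AM-GM bounds that product by
-- ((n − |X|)/(5 − |X|))^(5 − |X|).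
--
-- If X = {x}, write S as x a c d a′ x with a, a′ among the r neighbours and c, d among the b non-neighbours
-- of x.  With P(a, a′) the number of non-neighbours adjacent to a but not to a′, P(a, a′) + P(a′, a) ≤ b, so
--   |L| ≤ Σ_{a<a′} P(a, a′) P(a′, a) ≤ (b/4) Σ_{a,a′} P(a, a′) = (b/4) Σ_c t_c s_c ≤ b² r²/16,
-- where t_c + s_c = r splits the neighbours of x by adjacency to the non-neighbour c.

open import Defs hiding (sym)
open import Data.Bool using (Bool; true; false; not; _∧_)
import Data.Bool as Bool
import Data.Bool.Properties as Bool
open import Data.Fin using (Fin; zero; suc; _≟_; _<_)
open import Data.Fin.Properties using (all?; any?; _<?_; <-cmp; <-asym)
open import Data.Fin.Subset using (Subset; inside; outside; _∈_; _∉_; _⊆_; ∣_∣; ⁅_⁆; _∪_; ⊥)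
open import Data.Fin.Subset.Properties
  using (⊆-refl; ⊆-antisym; out⊆; x∈p∪q⁺; x∈p∪q⁻; x∈⁅x⁆; x∈⁅y⁆⇒x≡y; ∉⊥)
open import Data.List using (List; []; _∷_; length; map; foldr; filter; tabulate)
import Data.List.Properties as List
open import Data.List.Membership.Propositional using () renaming (_∈_ to _∈ₗ_)
open import Data.List.Membership.Propositional.Properties using (∈-map⁺; ∈-map⁻)
import Data.List.Membership.DecPropositional as DecMembership
open import Data.List.Relation.Unary.All as All using (All; []; _∷_)
open import Data.List.Relation.Unary.AllPairs using (AllPairs; []; _∷_)
open import Data.List.Relation.Unary.Any using (here; there)
open import Data.List.Relation.Unary.Unique.Propositional using (Unique)
open import Data.Nat using (ℕ; zero; suc; _+_; _*_; _∸_; _^_; _≤_; z≤n)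
open import Data.Nat.ListAction using () renaming (sum to sumᴸ)
open import Data.Nat.Properties
  using (≤-refl; ≤-reflexive; ≤-trans; ≤-total; m≤n⇒∃[o]m+o≡n; m≤m+n; m≤n+m; m+n≤o⇒m≤o∸n; suc-injective;
         +-comm; +-assoc; +-identityʳ; *-identityˡ; *-identityʳ; *-assoc; *-distribˡ-+; *-distribʳ-+;
         ^-distribˡ-+-*; +-mono-≤; +-monoʳ-≤; *-mono-≤; *-monoˡ-≤; *-monoʳ-≤; *-cancelˡ-≤; ^-monoˡ-≤;
         +-*-semiring; *-commutativeSemigroup; module ≤-Reasoning)
open import Data.Nat.Tactic.RingSolver using (solve-∀)
open import Algebra.Properties.Semiring.Sum +-*-semiring
  using (sum; sum-syntax; sum-cong-≗; sum-replicate-zero; ∑-distrib-+; ∑-comm; *-distribˡ-sum; *-distribʳ-sum)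
open import Data.Product using (Σ; ∃; ∃₂; _×_; _,_)
open import Data.Sum using (inj₁; inj₂)
import Data.Vec.Properties as Vec
open import Data.Vec using (_∷_; here; there)
open import Data.Vec.Functional using (Vector)
open import Function using (_∘_)
open import Function.Bundles using (_⇔_; mk⇔; Equivalence)
open import Relation.Binary.Definitions using (DecidableEquality; tri<; tri≈; tri>)
open import Relation.Binary.PropositionalEquality
  using (_≡_; _≢_; refl; sym; trans; cong; cong₂; subst; module ≡-Reasoning)
open import Relation.Nullary using (¬_; does; yes; no; contradiction)
open import Relation.Nullary.Decidable
  using (Dec; dec-true; dec-false; does-⇔; from-yes; ¬?; _⊎-dec_; _×-dec_; _→-dec_)
open import Relation.Unary using (Pred; Decidable)
open import Algebra.Properties.CommutativeSemigroup *-commutativeSemigroup using (x∙yz≈y∙xz)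

-- AM-GM inequalities

by-difference : (P : ℕ → ℕ → Set) → (∀ u d → P u (u + d)) → (∀ t d → P (t + d) t) → ∀ u t → P u t
by-difference P above below u t with ≤-total u t
... | inj₁ u≤t = let d , u+d≡t = m≤n⇒∃[o]m+o≡n u≤t in subst (P u) u+d≡t (above u d)
... | inj₂ t≤u = let d , t+d≡u = m≤n⇒∃[o]m+o≡n t≤u in subst (λ u → P u t) t+d≡u (below t d)

≤-by-gap : ∀ x z {y} → x + z ≡ y → x ≤ y
≤-by-gap x z refl = m≤m+n x z

-- (a + b)² − 4ab = (a − b)²
am-gm₂ : ∀ a b → 4 * (a * b) ≤ (a + b) * (a + b)
am-gm₂ = by-difference (λ a b → 4 * (a * b) ≤ (a + b) * (a + b))
  (λ a d → ≤-by-gap _ (d * d) (above a d))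
  (λ b d → ≤-by-gap _ (d * d) (below b d))
  where
  above : ∀ p q → 4 * (p * (p + q)) + q * q ≡ (p + (p + q)) * (p + (p + q))
  above = solve-∀
  below : ∀ p q → 4 * ((p + q) * p) + q * q ≡ (p + q + p) * (p + q + p)
  below = solve-∀

-- (u + 2t)³ − 27ut² = (u − t)²(u + 8t)
am-gm-twin : ∀ u t → 27 * (u * (t * t)) ≤ (u + 2 * t) ^ 3
am-gm-twin = by-difference (λ u t → 27 * (u * (t * t)) ≤ (u + 2 * t) ^ 3)
  (λ u d → ≤-by-gap _ (d * d * (9 * u + 8 * d)) (above u d))
  (λ t d → ≤-by-gap _ (d * d * (9 * t + d)) (below t d))
  where
  above : ∀ p q → 27 * (p * ((p + q) * (p + q))) + q * q * (9 * p + 8 * q)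
                  ≡ (p + 2 * (p + q)) * ((p + 2 * (p + q)) * ((p + 2 * (p + q)) * 1))
  above = solve-∀
  below : ∀ p q → 27 * ((p + q) * (p * p)) + q * q * (9 * p + q)
                  ≡ (p + q + 2 * p) * ((p + q + 2 * p) * ((p + q + 2 * p) * 1))
  below = solve-∀

am-gm₃ : ∀ a b c → 27 * (a * (b * c)) ≤ (a + b + c) ^ 3
am-gm₃ a b c = *-cancelˡ-≤ 8 (begin
  8 * (27 * (a * (b * c)))           ≡⟨ regroup a b c ⟩
  27 * (2 * a * (4 * (b * c)))       ≤⟨ *-monoʳ-≤ 27 (*-monoʳ-≤ (2 * a) (am-gm₂ b c)) ⟩
  27 * (2 * a * ((b + c) * (b + c))) ≤⟨ am-gm-twin (2 * a) (b + c) ⟩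
  (2 * a + 2 * (b + c)) ^ 3          ≡⟨ double a b c ⟩
  8 * (a + b + c) ^ 3                ∎)
  where
  open ≤-Reasoning
  regroup : ∀ a b c → 8 * (27 * (a * (b * c))) ≡ 27 * (2 * a * (4 * (b * c)))
  regroup = solve-∀
  double : ∀ a b c → (2 * a + 2 * (b + c)) * ((2 * a + 2 * (b + c)) * ((2 * a + 2 * (b + c)) * 1))
                     ≡ 8 * ((a + b + c) * ((a + b + c) * ((a + b + c) * 1)))
  double = solve-∀

am-gm₂-≤ : ∀ a b {m} → a + b ≤ m → 4 * (a * b) ≤ m ^ 2
am-gm₂-≤ a b {m} a+b≤m =
  ≤-trans (am-gm₂ a b)
          (subst ((a + b) * (a + b) ≤_) (cong (m *_) (sym (*-identityʳ m))) (*-mono-≤ a+b≤m a+b≤m))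

am-gm₃-≤ : ∀ a b c {m} → a + b + c ≤ m → 27 * (a * (b * c)) ≤ m ^ 3
am-gm₃-≤ a b c a+b+c≤m = ≤-trans (am-gm₃ a b c) (^-monoˡ-≤ 3 a+b+c≤m)

am-gm₂-scaled : ∀ a b {m} → a + b ≤ m → 4 * (a * b) ≤ m * (a + b)
am-gm₂-scaled a b a+b≤m = ≤-trans (am-gm₂ a b) (*-monoˡ-≤ (a + b) a+b≤m)

am-gm₂-squared : ∀ a b {m} → a + b ≤ m → 16 * (a ^ 2 * b ^ 2) ≤ m ^ 4
am-gm₂-squared a b {m} a+b≤m = begin
  16 * (a ^ 2 * b ^ 2)              ≡⟨ square a b ⟩
  4 * (a * b) * (4 * (a * b))       ≤⟨ *-mono-≤ (am-gm₂-≤ a b a+b≤m) (am-gm₂-≤ a b a+b≤m) ⟩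
  m ^ 2 * m ^ 2                     ≡⟨ ^-distribˡ-+-* m 2 2 ⟨
  m ^ 4                             ∎
  where
  open ≤-Reasoning
  square : ∀ a b → 16 * (a * (a * 1) * (b * (b * 1))) ≡ 4 * (a * b) * (4 * (a * b))
  square = solve-∀

-- Indicators and finite sums

𝟙 : Bool → ℕ
𝟙 true  = 1
𝟙 false = 0

𝟙-∧ : ∀ a b → 𝟙 (a ∧ b) ≡ 𝟙 a * 𝟙 b
𝟙-∧ true  b = sym (+-identityʳ (𝟙 b))
𝟙-∧ false b = refl

𝟙-split : ∀ a b → 𝟙 (a ∧ not b) + 𝟙 (a ∧ b) ≡ 𝟙 a
𝟙-split true  true  = refl
𝟙-split true  false = refl
𝟙-split false b     = refl

𝟙-complement : ∀ a → 𝟙 a + 𝟙 (not a) ≡ 1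
𝟙-complement true  = refl
𝟙-complement false = refl

𝟙-private : ∀ m p q → 𝟙 (m ∧ (p ∧ not q)) + 𝟙 (m ∧ (q ∧ not p)) ≤ 𝟙 m
𝟙-private false p     q     = z≤n
𝟙-private true  true  true  = z≤n
𝟙-private true  true  false = ≤-refl
𝟙-private true  false true  = ≤-refl
𝟙-private true  false false = z≤n

𝟙-exclusive : ∀ {A B : Set} → (A → ¬ B) → (a? : Dec A) (b? : Dec B) → 𝟙 (does a?) + 𝟙 (does b?) ≤ 1
𝟙-exclusive A⇒¬B (yes a) (yes b) = contradiction b (A⇒¬B a)
𝟙-exclusive A⇒¬B (yes _) (no  _) = ≤-refl
𝟙-exclusive A⇒¬B (no  _) (yes _) = ≤-refl
𝟙-exclusive A⇒¬B (no  _) (no  _) = z≤n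

sum-mono-≤ : ∀ {n} {f g : Vector ℕ n} → (∀ i → f i ≤ g i) → sum f ≤ sum g
sum-mono-≤ {zero}  f≤g = z≤n
sum-mono-≤ {suc n} f≤g = +-mono-≤ (f≤g zero) (sum-mono-≤ (f≤g ∘ suc))

term≤sum : ∀ {n} (f : Vector ℕ n) i → f i ≤ sum f
term≤sum f zero    = m≤m+n (f zero) _
term≤sum f (suc i) = ≤-trans (term≤sum (f ∘ suc) i) (m≤n+m _ (f zero))

sum≤size : ∀ {n} {f : Vector ℕ n} → (∀ i → f i ≤ 1) → sum f ≤ n
sum≤size {zero}  f≤1 = z≤n
sum≤size {suc n} f≤1 = +-mono-≤ (f≤1 zero) (sum≤size (f≤1 ∘ suc))

∑∑-* : ∀ {m n} (f : Vector ℕ m) (g : Vector ℕ n) → ∑[ i < m ] ∑[ j < n ] (f i * g j) ≡ sum f * sum g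
∑∑-* f g = trans (sum-cong-≗ (λ i → sym (*-distribˡ-sum (f i) g))) (sym (*-distribʳ-sum (sum g) f))

∑∑-scaled : ∀ {m n} w (f : Vector ℕ m) (g : Vector ℕ n) →
            ∑[ i < m ] ∑[ j < n ] (w * (f i * g j)) ≡ w * (sum f * sum g)
∑∑-scaled w f g = trans (sum-cong-≗ (λ i → sym (*-distribˡ-sum w (λ j → f i * g j))))
                    (trans (sym (*-distribˡ-sum w (λ i → sum (λ j → f i * g j)))) (cong (w *_) (∑∑-* f g)))

∑∑∑-* : ∀ {l m n} (f : Vector ℕ l) (g : Vector ℕ m) (h : Vector ℕ n) →
        ∑[ i < l ] ∑[ j < m ] ∑[ k < n ] (f i * (g j * h k)) ≡ sum f * (sum g * sum h)
∑∑∑-* f g h = trans (sum-cong-≗ (λ i → ∑∑-scaled (f i) g h)) (sym (*-distribʳ-sum (sum g * sum h) f))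

∑∑-distribˡ : ∀ {m n} w (f : Fin m → Fin n → ℕ) →
              ∑[ i < m ] ∑[ j < n ] (w * f i j) ≡ w * ∑[ i < m ] ∑[ j < n ] f i j
∑∑-distribˡ w f =
  trans (sum-cong-≗ (λ i → sym (*-distribˡ-sum w (f i)))) (sym (*-distribˡ-sum w (λ i → sum (f i))))

∑∑-symmetrise : ∀ {n} (f : Fin n → Fin n → ℕ) →
                ∑[ i < n ] ∑[ j < n ] (𝟙 (does (i <? j)) * (f i j + f j i)) ≤ ∑[ i < n ] ∑[ j < n ] f i j
∑∑-symmetrise {n} f = begin
  ∑[ i < n ] ∑[ j < n ] (ord i j * (f i j + f j i))
    ≡⟨ sum-cong-≗ (λ i → trans (sum-cong-≗ λ j → *-distribˡ-+ (ord i j) (f i j) (f j i))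
                                (∑-distrib-+ (λ j → ord i j * f i j) (λ j → ord i j * f j i))) ⟩
  ∑[ i < n ] (∑[ j < n ] (ord i j * f i j) + ∑[ j < n ] (ord i j * f j i))
    ≡⟨ ∑-distrib-+ (λ i → ∑[ j < n ] (ord i j * f i j)) (λ i → ∑[ j < n ] (ord i j * f j i)) ⟩
  ∑[ i < n ] ∑[ j < n ] (ord i j * f i j) + ∑[ i < n ] ∑[ j < n ] (ord i j * f j i)
    ≡⟨ cong (∑[ i < n ] ∑[ j < n ] (ord i j * f i j) +_) (∑-comm (λ i j → ord i j * f j i)) ⟩
  ∑[ i < n ] ∑[ j < n ] (ord i j * f i j) + ∑[ i < n ] ∑[ j < n ] (ord j i * f i j)
    ≡⟨ ∑-distrib-+ (λ i → ∑[ j < n ] (ord i j * f i j)) (λ i → ∑[ j < n ] (ord j i * f i j)) ⟨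
  ∑[ i < n ] (∑[ j < n ] (ord i j * f i j) + ∑[ j < n ] (ord j i * f i j))
    ≡⟨ sum-cong-≗ (λ i → sym (∑-distrib-+ (λ j → ord i j * f i j) (λ j → ord j i * f i j))) ⟩
  ∑[ i < n ] ∑[ j < n ] (ord i j * f i j + ord j i * f i j)
    ≤⟨ sum-mono-≤ (λ i → sum-mono-≤ (λ j → at-most-once i j)) ⟩
  ∑[ i < n ] ∑[ j < n ] f i j ∎
  where
  open ≤-Reasoning
  ord : Fin n → Fin n → ℕ
  ord i j = 𝟙 (does (i <? j))
  at-most-once : ∀ i j → ord i j * f i j + ord j i * f i j ≤ f i j
  at-most-once i j = begin
    ord i j * f i j + ord j i * f i j ≡⟨ *-distribʳ-+ (f i j) (ord i j) (ord j i) ⟨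
    (ord i j + ord j i) * f i j       ≤⟨ *-monoˡ-≤ (f i j) (𝟙-exclusive <-asym (i <? j) (j <? i)) ⟩
    1 * f i j                         ≡⟨ *-identityˡ (f i j) ⟩
    f i j                             ∎

length-filter-tabulate : ∀ {A : Set} {p} {P : Pred A p} (P? : Decidable P) {n} (f : Fin n → A) →
                         length (filter P? (tabulate f)) ≡ ∑[ i < n ] 𝟙 (does (P? (f i)))
length-filter-tabulate P? {zero}  f = refl
length-filter-tabulate P? {suc n} f with does (P? (f zero))
... | true  = cong suc (length-filter-tabulate P? (f ∘ suc))
... | false = length-filter-tabulate P? (f ∘ suc)

sumᴸ-zeros : ∀ {A : Set} (as : List A) → sumᴸ (map (λ _ → 0) as) ≡ 0
sumᴸ-zeros []       = refl
sumᴸ-zeros (_ ∷ as) = sumᴸ-zeros as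

∑-sumᴸ-comm : ∀ {A : Set} {k} (f : A → Fin k → ℕ) (as : List A) →
              ∑[ u < k ] sumᴸ (map (λ a → f a u) as) ≡ sumᴸ (map (λ a → ∑[ u < k ] f a u) as)
∑-sumᴸ-comm {k = k} f []       = sum-replicate-zero k
∑-sumᴸ-comm         f (a ∷ as) = trans (∑-distrib-+ (f a) _) (cong (_ +_) (∑-sumᴸ-comm f as))

module _ {A : Set} (_≟_ : DecidableEquality A) where

  matches : A → List A → ℕ
  matches t as = sumᴸ (map (λ a → 𝟙 (does (t ≟ a))) as)

  matches≡0 : ∀ t {as} → All (t ≢_) as → matches t as ≡ 0
  matches≡0 t []                   = refl
  matches≡0 t {a ∷ _} (t≢a ∷ t≢as) = cong₂ _+_ (cong 𝟙 (dec-false (t ≟ a) t≢a)) (matches≡0 t t≢as)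

  matches≤1 : ∀ t {as} → AllPairs _≢_ as → matches t as ≤ 1
  matches≤1 t []                   = z≤n
  matches≤1 t {a ∷ _} (a≢as ∷ distinct) with t ≟ a
  ... | yes refl = ≤-reflexive (cong suc (matches≡0 t a≢as))
  ... | no  _    = matches≤1 t distinct

-- Counting by injective encoding

record Summable (K : Set) : Set where
  field
    total        : (K → ℕ) → ℕ
    total-cong   : ∀ {f g} → (∀ k → f k ≡ g k) → total f ≡ total g
    total-+      : ∀ f g → total (λ k → f k + g k) ≡ total f + total g
    term≤total   : ∀ f k → f k ≤ total f
open Summable public

fin-summable : ∀ n → Summable (Fin n)
fin-summable n = record
  { total = sum ; total-cong = sum-cong-≗ ; total-+ = ∑-distrib-+ ; term≤total = term≤sum }

_×-summable_ : ∀ {A B} → Summable A → Summable B → Summable (A × B)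
𝔸 ×-summable 𝔹 = record
  { total      = λ f → total 𝔸 (λ a → total 𝔹 (λ b → f (a , b)))
  ; total-cong = λ f≗g → total-cong 𝔸 (λ a → total-cong 𝔹 (λ b → f≗g (a , b)))
  ; total-+    = λ f g → trans (total-cong 𝔸 (λ a → total-+ 𝔹 _ _)) (total-+ 𝔸 _ _)
  ; term≤total = λ { f (a , b) → ≤-trans (term≤total 𝔹 _ b) (term≤total 𝔸 _ a) }
  }

Encoded : ∀ {K A : Set} → (K → A) → (K → Bool) → A → Set
Encoded decode R a = ∃ λ k → R k ≡ true × decode k ≡ a

module _ {K A : Set} (𝕂 : Summable K) (_≟_ : DecidableEquality A) (decode : K → A) where

  length≤count : ∀ R {as} → Unique as → All (Encoded decode R) as → length as ≤ total 𝕂 (𝟙 ∘ R)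
  length≤count R {[]}     []             []                      = z≤n
  length≤count R {a ∷ as} (a∉as ∷ uniq) ((k , Rk , k↦a) ∷ encs) = begin
    suc (length as)                      ≡⟨ +-comm 1 (length as) ⟩
    length as + 1                        ≤⟨ +-mono-≤ (length≤count Rₒ uniq (All.zipWith elsewhere (a∉as , encs))) hit ⟩
    total 𝕂 (𝟙 ∘ Rₒ) + total 𝕂 (𝟙 ∘ Rₐ) ≡⟨ total-+ 𝕂 _ _ ⟨
    total 𝕂 (λ k → 𝟙 (Rₒ k) + 𝟙 (Rₐ k)) ≡⟨ total-cong 𝕂 (λ k → 𝟙-split (R k) _) ⟩
    total 𝕂 (𝟙 ∘ R)                      ∎
    where
    open ≤-Reasoning
    Rₐ Rₒ : K → Bool
    Rₐ k = R k ∧ does (decode k ≟ a)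
    Rₒ k = R k ∧ not (does (decode k ≟ a))
    hit : 1 ≤ total 𝕂 (𝟙 ∘ Rₐ)
    hit = subst (_≤ total 𝕂 (𝟙 ∘ Rₐ)) (cong 𝟙 (cong₂ _∧_ Rk (dec-true (decode k ≟ a) k↦a)))
                (term≤total 𝕂 (𝟙 ∘ Rₐ) k)
    elsewhere : ∀ {b} → a ≢ b × Encoded decode R b → Encoded decode Rₒ b
    elsewhere (a≢b , k′ , Rk′ , k′↦b) =
      k′ , cong₂ _∧_ Rk′ (cong not (dec-false (decode k′ ≟ a) λ k′↦a → a≢b (trans (sym k′↦a) k′↦b))) , k′↦b

fromList : ∀ {n} → List (Fin n) → Subset n
fromList = foldr (λ x S → ⁅ x ⁆ ∪ S) ⊥

∈-fromList⁺ : ∀ {n} {u : Fin n} {xs} → u ∈ₗ xs → u ∈ fromList xs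
∈-fromList⁺ (here refl)  = x∈p∪q⁺ (inj₁ (x∈⁅x⁆ _))
∈-fromList⁺ (there u∈xs) = x∈p∪q⁺ (inj₂ (∈-fromList⁺ u∈xs))

∈-fromList⁻ : ∀ {n} {u : Fin n} xs → u ∈ fromList xs → u ∈ₗ xs
∈-fromList⁻ (x ∷ xs) u∈ with x∈p∪q⁻ ⁅ x ⁆ (fromList xs) u∈
... | inj₁ u∈⁅x⁆ = here (x∈⁅y⁆⇒x≡y x u∈⁅x⁆)
... | inj₂ u∈xs  = there (∈-fromList⁻ xs u∈xs)
∈-fromList⁻ []       u∈ = contradiction u∈ ∉⊥

_≟ˢ_ : ∀ {n} → DecidableEquality (Subset n)
_≟ˢ_ = Vec.≡-dec Bool._≟_

pick : ∀ {n k} (X : Subset n) → ∣ X ∣ ≡ suc k →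
       ∃ λ x → x ∈ X × Σ (Subset n) λ Y → Y ⊆ X × x ∉ Y × ∣ Y ∣ ≡ k
pick (inside  ∷ X) ∣X∣≡1+k = zero , here , outside ∷ X , out⊆ ⊆-refl , (λ ()) , suc-injective ∣X∣≡1+k
pick (outside ∷ X) ∣X∣≡1+k with pick X ∣X∣≡1+k
... | x , x∈X , Y , Y⊆X , x∉Y , ∣Y∣≡k =
  suc x , there x∈X , outside ∷ Y , out⊆ Y⊆X , (λ { (there x∈Y) → x∉Y x∈Y }) , ∣Y∣≡k

two-distinct : ∀ {n} (X : Subset n) → ∣ X ∣ ≡ 2 → ∃₂ λ x y → x ∈ X × y ∈ X × x ≢ y
two-distinct X ∣X∣≡2 with pick X ∣X∣≡2
... | x , x∈X , Y , Y⊆X , x∉Y , ∣Y∣≡1 with pick Y ∣Y∣≡1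
... | y , y∈Y , _ = x , y , x∈X , Y⊆X y∈Y , λ { refl → x∉Y y∈Y }

three-distinct : ∀ {n} (X : Subset n) → ∣ X ∣ ≡ 3 →
                 ∃₂ λ x y → ∃ λ z → (x ∈ X × y ∈ X × z ∈ X) × (x ≢ y × y ≢ z × x ≢ z)
three-distinct X ∣X∣≡3 with pick X ∣X∣≡3
... | x , x∈X , Y , Y⊆X , x∉Y , ∣Y∣≡2 with pick Y ∣Y∣≡2
... | y , y∈Y , Z , Z⊆Y , y∉Z , ∣Z∣≡1 with pick Z ∣Z∣≡1
... | z , z∈Z , _ =
  x , y , z , (x∈X , Y⊆X y∈Y , Y⊆X (Z⊆Y z∈Z)) ,
  ((λ { refl → x∉Y y∈Y }) , (λ { refl → y∉Z z∈Z }) , (λ { refl → x∉Y (Z⊆Y z∈Z) }))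

-- Adjacency profiles and embedded 5-cycles

_∈?_ : ∀ {n} (u : Fin n) xs → Dec (u ∈ₗ xs)
u ∈? xs = DecMembership._∈?_ _≟_ u xs

_≟ᴮ_ : DecidableEquality (List Bool)
_≟ᴮ_ = List.≡-dec Bool._≟_

module Profiles {k} (adj : Fin k → Fin k → Bool) (xs : List (Fin k)) where

  profile : Fin k → List Bool
  profile u = map (λ x → adj x u) xs

  InClass : List Bool → Fin k → Bool
  InClass T u = not (does (u ∈? xs)) ∧ does (profile u ≟ᴮ T)

  classSize : List Bool → ℕ
  classSize T = ∑[ u < k ] 𝟙 (InClass T u)

  classSizes+length≤k : Unique xs → ∀ {Ts} → AllPairs _≢_ Ts → sumᴸ (map classSize Ts) + length xs ≤ k
  classSizes+length≤k unique-xs {Ts} distinct = begin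
    sumᴸ (map classSize Ts) + length xs
      ≤⟨ +-monoʳ-≤ _ (length≤count (fin-summable k) _≟_ (λ u → u) (λ u → does (u ∈? xs)) unique-xs
                       (All.tabulate λ {x} x∈xs → x , dec-true (x ∈? xs) x∈xs , refl)) ⟩
    sumᴸ (map classSize Ts) + ∑[ u < k ] 𝟙 (does (u ∈? xs))
      ≡⟨ cong (_+ _) (∑-sumᴸ-comm (λ T u → 𝟙 (InClass T u)) Ts) ⟨
    ∑[ u < k ] sumᴸ (map (λ T → 𝟙 (InClass T u)) Ts) + ∑[ u < k ] 𝟙 (does (u ∈? xs))
      ≡⟨ ∑-distrib-+ (λ u → sumᴸ (map (λ T → 𝟙 (InClass T u)) Ts)) (λ u → 𝟙 (does (u ∈? xs))) ⟨
    ∑[ u < k ] (sumᴸ (map (λ T → 𝟙 (InClass T u)) Ts) + 𝟙 (does (u ∈? xs)))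
      ≤⟨ sum≤size (λ u → in-one-class (does (u ∈? xs)) (profile u)) ⟩
    k ∎
    where
    open ≤-Reasoning
    in-one-class : ∀ b t → sumᴸ (map (λ T → 𝟙 (not b ∧ does (t ≟ᴮ T))) Ts) + 𝟙 b ≤ 1
    in-one-class true  t = ≤-reflexive (cong (_+ 1) (sumᴸ-zeros Ts))
    in-one-class false t = ≤-trans (≤-reflexive (+-identityʳ _)) (matches≤1 _≟ᴮ_ t distinct)

c5-adj? : ∀ i j → Dec (C5Adj i j)
c5-adj? i j = (j ≟ suc5 i) ⊎-dec (i ≟ suc5 j)

c5 : Fin 5 → Fin 5 → Bool
c5 i j = does (c5-adj? i j)

does-≟-true : ∀ b → does (b Bool.≟ true) ≡ b
does-≟-true true  = refl
does-≟-true false = refl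

record C5Embedding {n} (G : Graph n) (S : Subset n) : Set where
  field
    vertex           : Fin 5 → Fin n
    vertex-injective : ∀ {i j} → vertex i ≡ vertex j → i ≡ j
    edge             : ∀ i j → E G (vertex i) (vertex j) ≡ c5 i j
    ∈-vertices       : ∀ u → u ∈ S ⇔ ∃ λ i → vertex i ≡ u

embedding : ∀ {n} {G : Graph n} {S} → InducesC5 G S → C5Embedding G S
embedding {G = G} (_ , v , v-injective , ∈S⇔ , edge⇔) = record
  { vertex           = v
  ; vertex-injective = v-injective
  ; edge             = λ i j →
      trans (sym (does-≟-true _)) (does-⇔ (edge⇔ i j) (E G (v i) (v j) Bool.≟ true) (c5-adj? i j))
  ; ∈-vertices       = ∈S⇔
  }

Covers : List (Fin 5) → Set
Covers ms = ∀ m → m ∈ₗ ms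

covers? : ∀ ms → Dec (Covers ms)
covers? ms = all? (_∈? ms)

module Embedded {n} {G : Graph n} {S} (𝕖 : C5Embedding G S) where
  open C5Embedding 𝕖

  located : ∀ {u} → u ∈ S → ∃ λ i → vertex i ≡ u
  located = Equivalence.to (∈-vertices _)

  vertex-set : ∀ ms → Covers ms → fromList (map vertex ms) ≡ S
  vertex-set ms covers = ⊆-antisym listed⊆S S⊆listed
    where
    listed⊆S : fromList (map vertex ms) ⊆ S
    listed⊆S u∈ with ∈-map⁻ vertex (∈-fromList⁻ (map vertex ms) u∈)
    ... | i , _ , refl = Equivalence.from (∈-vertices _) (i , refl)
    S⊆listed : S ⊆ fromList (map vertex ms)
    S⊆listed u∈S with located u∈S
    ... | i , refl = ∈-fromList⁺ {xs = map vertex ms} (∈-map⁺ vertex (covers i))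

  ∈-map-vertex : ∀ m is → does (vertex m ∈? map vertex is) ≡ does (m ∈? is)
  ∈-map-vertex m is = does-⇔ (mk⇔ reflect (∈-map⁺ vertex)) (vertex m ∈? map vertex is) (m ∈? is)
    where
    reflect : vertex m ∈ₗ map vertex is → m ∈ₗ is
    reflect vm∈ with ∈-map⁻ vertex vm∈
    ... | i , i∈is , vm≡vi = subst (_∈ₗ is) (sym (vertex-injective vm≡vi)) i∈is

  InClass-vertex : ∀ is T m → Profiles.InClass (E G) (map vertex is) T (vertex m) ≡ Profiles.InClass c5 is T m
  InClass-vertex is T m =
    cong₂ _∧_ (cong not (∈-map-vertex m is)) (cong (λ t → does (t ≟ᴮ T)) profile-vertex)
    where
    profile-vertex : Profiles.profile (E G) (map vertex is) (vertex m) ≡ Profiles.profile c5 is m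
    profile-vertex = trans (sym (List.map-∘ is)) (List.map-cong (λ i → edge i m) is)

-- 5-cycles through three vertices

-- Profiles relative to (x, y, z) of the two other vertices of a 5-cycle through x, y, z, as a function of
-- which of xy, yz, xz are edges. The last clauses are for edge patterns that no three vertices of C₅ have.
T₁ T₂ : Bool → Bool → Bool → List Bool
T₁ true  true  false = true  ∷ false ∷ false ∷ []
T₁ true  false true  = false ∷ true  ∷ false ∷ []
T₁ false true  true  = true  ∷ false ∷ false ∷ []
T₁ true  false false = true  ∷ false ∷ true  ∷ []
T₁ false true  false = true  ∷ true  ∷ false ∷ []
T₁ false false true  = true  ∷ true  ∷ false ∷ []
T₁ _     _     _     = false ∷ false ∷ false ∷ []
T₂ true  true  false = false ∷ false ∷ true  ∷ []
T₂ true  false true  = false ∷ false ∷ true  ∷ []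
T₂ false true  true  = false ∷ true  ∷ false ∷ []
T₂ true  false false = false ∷ true  ∷ true  ∷ []
T₂ false true  false = true  ∷ false ∷ true  ∷ []
T₂ false false true  = false ∷ true  ∷ true  ∷ []
T₂ _     _     _     = true  ∷ true  ∷ true  ∷ []

T₁≢T₂ : ∀ a b c → T₁ a b c ≢ T₂ a b c
T₁≢T₂ true  true  true  ()
T₁≢T₂ true  true  false ()
T₁≢T₂ true  false true  ()
T₁≢T₂ true  false false ()
T₁≢T₂ false true  true  ()
T₁≢T₂ false true  false ()
T₁≢T₂ false false true  ()
T₁≢T₂ false false false ()

module Through₃ {k} (adj : Fin k → Fin k → Bool) (x y z : Fin k) where
  open Profiles adj (x ∷ y ∷ z ∷ []) public

  Tᴬ Tᴮ : List Bool
  Tᴬ = T₁ (adj x y) (adj y z) (adj x z)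
  Tᴮ = T₂ (adj x y) (adj y z) (adj x z)

  Admissible : Fin k × Fin k → Bool
  Admissible (p , q) = InClass Tᴬ p ∧ InClass Tᴮ q

  completed : Fin k × Fin k → List (Fin k)
  completed (p , q) = x ∷ y ∷ z ∷ p ∷ q ∷ []

  Coded : Subset k → Set
  Coded = Encoded (fromList ∘ completed) Admissible

Completion₃ : Fin 5 → Fin 5 → Fin 5 → Set
Completion₃ i j k = ∃₂ λ p q → Admissible (p , q) ≡ true × Covers (completed (p , q))
  where open Through₃ c5 i j k

c5-completion₃ : ∀ i j k → i ≢ j → j ≢ k → i ≢ k → Completion₃ i j k
c5-completion₃ = from-yes (all? λ i → all? λ j → all? λ k → ¬? (i ≟ j) →-dec ¬? (j ≟ k) →-dec ¬? (i ≟ k) →-dec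
  any? λ p → any? λ q →
    (Through₃.Admissible c5 i j k (p , q) Bool.≟ true) ×-dec covers? (i ∷ j ∷ k ∷ p ∷ q ∷ []))

encode₃ : ∀ {n} (G : Graph n) {S} → InducesC5 G S →
          ∀ {x y z} → x ∈ S × y ∈ S × z ∈ S → x ≢ y → y ≢ z → x ≢ z → Through₃.Coded (E G) x y z S
encode₃ G {S} C5 = encode
  where
  𝕖 : C5Embedding G S
  𝕖 = embedding C5
  open C5Embedding 𝕖
  open Embedded 𝕖
  transport : ∀ i j k p q → Through₃.Admissible (E G) (vertex i) (vertex j) (vertex k) (vertex p , vertex q)
                          ≡ Through₃.Admissible c5 i j k (p , q)
  transport i j k p q rewrite edge i j | edge j k | edge i k =
    cong₂ _∧_ (InClass-vertex (i ∷ j ∷ k ∷ []) (Through₃.Tᴬ c5 i j k) p)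
              (InClass-vertex (i ∷ j ∷ k ∷ []) (Through₃.Tᴮ c5 i j k) q)
  complete : ∀ i j k → Completion₃ i j k → Through₃.Coded (E G) (vertex i) (vertex j) (vertex k) S
  complete i j k (p , q , admissible , covers) =
    (vertex p , vertex q) , trans (transport i j k p q) admissible , vertex-set (i ∷ j ∷ k ∷ p ∷ q ∷ []) covers
  encode : ∀ {x y z} → x ∈ S × y ∈ S × z ∈ S → x ≢ y → y ≢ z → x ≢ z → Through₃.Coded (E G) x y z S
  encode (x∈S , y∈S , z∈S) x≢y y≢z x≢z with located x∈S | located y∈S | located z∈S
  ... | i , refl | j , refl | k , refl =
    complete i j k (c5-completion₃ i j k (x≢y ∘ cong vertex) (y≢z ∘ cong vertex) (x≢z ∘ cong vertex))

c5s-through-three : ∀ {n} (G : Graph n) {x y z} → x ≢ y → y ≢ z → x ≢ z →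
                    ∀ {L} → C5Family G (λ S → x ∈ S × y ∈ S × z ∈ S) L → 4 * length L ≤ (n ∸ 3) ^ 2
c5s-through-three {n} G {x} {y} {z} x≢y y≢z x≢z {L} (unique , members) = begin
  4 * length L
    ≤⟨ *-monoʳ-≤ 4 (length≤count (fin-summable n ×-summable fin-summable n) _≟ˢ_ (fromList ∘ completed)
                      Admissible unique (All.map (λ (∈S , C5) → encode₃ G C5 ∈S x≢y y≢z x≢z) members)) ⟩
  4 * ∑[ p < n ] ∑[ q < n ] 𝟙 (InClass Tᴬ p ∧ InClass Tᴮ q)
    ≡⟨ cong (4 *_) (trans (sum-cong-≗ λ p → sum-cong-≗ λ q → 𝟙-∧ (InClass Tᴬ p) (InClass Tᴮ q))
                          (∑∑-* (𝟙 ∘ InClass Tᴬ) (𝟙 ∘ InClass Tᴮ))) ⟩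
  4 * (A * B)
    ≤⟨ am-gm₂-≤ A B (m+n≤o⇒m≤o∸n (A + B) sizes) ⟩
  (n ∸ 3) ^ 2 ∎
  where
  open ≤-Reasoning
  open Through₃ (E G) x y z
  A B : ℕ
  A = classSize Tᴬ
  B = classSize Tᴮ
  sizes : A + B + 3 ≤ n
  sizes = subst (λ s → s + 3 ≤ n) (cong (A +_) (+-identityʳ B))
            (classSizes+length≤k ((x≢y ∷ x≢z ∷ []) ∷ (y≢z ∷ []) ∷ [] ∷ [])
                                 ((T₁≢T₂ (E G x y) (E G y z) (E G x z) ∷ []) ∷ [] ∷ []))

-- 5-cycles through two vertices

-- Profiles relative to (x, y) of the three other vertices of a 5-cycle through x and y, as a function of xy ∈ E.
S₁ S₂ S₃ : Bool → List Bool
S₁ true  = false ∷ true  ∷ []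
S₁ false = true  ∷ true  ∷ []
S₂ true  = false ∷ false ∷ []
S₂ false = false ∷ true  ∷ []
S₃ _     = true  ∷ false ∷ []

S-distinct : ∀ e → AllPairs _≢_ (S₁ e ∷ S₂ e ∷ S₃ e ∷ [])
S-distinct true  = ((λ ()) ∷ (λ ()) ∷ []) ∷ ((λ ()) ∷ []) ∷ [] ∷ []
S-distinct false = ((λ ()) ∷ (λ ()) ∷ []) ∷ ((λ ()) ∷ []) ∷ [] ∷ []

module Through₂ {k} (adj : Fin k → Fin k → Bool) (x y : Fin k) where
  open Profiles adj (x ∷ y ∷ []) public

  Sᴬ Sᴮ Sᶜ : List Bool
  Sᴬ = S₁ (adj x y)
  Sᴮ = S₂ (adj x y)
  Sᶜ = S₃ (adj x y)

  Admissible : Fin k × Fin k × Fin k → Bool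
  Admissible (p , q , r) = InClass Sᴬ p ∧ (InClass Sᴮ q ∧ InClass Sᶜ r)

  completed : Fin k × Fin k × Fin k → List (Fin k)
  completed (p , q , r) = x ∷ y ∷ p ∷ q ∷ r ∷ []

  Coded : Subset k → Set
  Coded = Encoded (fromList ∘ completed) Admissible

Completion₂ : Fin 5 → Fin 5 → Set
Completion₂ i j = ∃₂ λ p q → ∃ λ r → Admissible (p , q , r) ≡ true × Covers (completed (p , q , r))
  where open Through₂ c5 i j

c5-completion₂ : ∀ i j → i ≢ j → Completion₂ i j
c5-completion₂ = from-yes (all? λ i → all? λ j → ¬? (i ≟ j) →-dec any? λ p → any? λ q → any? λ r →
  (Through₂.Admissible c5 i j (p , q , r) Bool.≟ true) ×-dec covers? (i ∷ j ∷ p ∷ q ∷ r ∷ []))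

encode₂ : ∀ {n} (G : Graph n) {S} → InducesC5 G S →
          ∀ {x y} → x ∈ S × y ∈ S → x ≢ y → Through₂.Coded (E G) x y S
encode₂ G {S} C5 = encode
  where
  𝕖 : C5Embedding G S
  𝕖 = embedding C5
  open C5Embedding 𝕖
  open Embedded 𝕖
  transport : ∀ i j p q r → Through₂.Admissible (E G) (vertex i) (vertex j) (vertex p , vertex q , vertex r)
                            ≡ Through₂.Admissible c5 i j (p , q , r)
  transport i j p q r rewrite edge i j =
    cong₂ _∧_ (InClass-vertex (i ∷ j ∷ []) (Through₂.Sᴬ c5 i j) p)
              (cong₂ _∧_ (InClass-vertex (i ∷ j ∷ []) (Through₂.Sᴮ c5 i j) q)
                         (InClass-vertex (i ∷ j ∷ []) (Through₂.Sᶜ c5 i j) r))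
  complete : ∀ i j → Completion₂ i j → Through₂.Coded (E G) (vertex i) (vertex j) S
  complete i j (p , q , r , admissible , covers) =
    (vertex p , vertex q , vertex r) , trans (transport i j p q r) admissible ,
    vertex-set (i ∷ j ∷ p ∷ q ∷ r ∷ []) covers
  encode : ∀ {x y} → x ∈ S × y ∈ S → x ≢ y → Through₂.Coded (E G) x y S
  encode (x∈S , y∈S) x≢y with located x∈S | located y∈S
  ... | i , refl | j , refl = complete i j (c5-completion₂ i j (x≢y ∘ cong vertex))

c5s-through-two : ∀ {n} (G : Graph n) {x y} → x ≢ y →
                  ∀ {L} → C5Family G (λ S → x ∈ S × y ∈ S) L → 27 * length L ≤ (n ∸ 2) ^ 3
c5s-through-two {n} G {x} {y} x≢y {L} (unique , members) = begin
  27 * length L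
    ≤⟨ *-monoʳ-≤ 27 (length≤count (fin-summable n ×-summable (fin-summable n ×-summable fin-summable n)) _≟ˢ_
                       (fromList ∘ completed) Admissible unique (All.map (λ (∈S , C5) → encode₂ G C5 ∈S x≢y) members)) ⟩
  27 * ∑[ p < n ] ∑[ q < n ] ∑[ r < n ] 𝟙 (Admissible (p , q , r))
    ≡⟨ cong (27 *_) (trans (sum-cong-≗ λ p → sum-cong-≗ λ q → sum-cong-≗ λ r → factor p q r)
                           (∑∑∑-* (𝟙 ∘ InClass Sᴬ) (𝟙 ∘ InClass Sᴮ) (𝟙 ∘ InClass Sᶜ))) ⟩
  27 * (A * (B * C))
    ≤⟨ am-gm₃-≤ A B C (m+n≤o⇒m≤o∸n (A + B + C) sizes) ⟩
  (n ∸ 2) ^ 3 ∎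
  where
  open ≤-Reasoning
  open Through₂ (E G) x y
  A B C : ℕ
  A = classSize Sᴬ
  B = classSize Sᴮ
  C = classSize Sᶜ
  factor : ∀ p q r → 𝟙 (Admissible (p , q , r)) ≡ 𝟙 (InClass Sᴬ p) * (𝟙 (InClass Sᴮ q) * 𝟙 (InClass Sᶜ r))
  factor p q r =
    trans (𝟙-∧ (InClass Sᴬ p) _) (cong (𝟙 (InClass Sᴬ p) *_) (𝟙-∧ (InClass Sᴮ q) (InClass Sᶜ r)))
  sizes : A + B + C + 2 ≤ n
  sizes = subst (λ s → s + 2 ≤ n) (trans (cong (λ c → A + (B + c)) (+-identityʳ C)) (sym (+-assoc A B C)))
            (classSizes+length≤k ((x≢y ∷ []) ∷ [] ∷ []) (S-distinct (E G x y)))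

-- 5-cycles through one vertex

module Around {k} (adj : Fin k → Fin k → Bool) (x : Fin k) where
  open Profiles adj (x ∷ []) public

  Nbr NonNbr : Fin k → Bool
  Nbr    = InClass (true ∷ [])
  NonNbr = InClass (false ∷ [])

  Private : Fin k → Fin k → Fin k → Bool
  Private a b c = NonNbr c ∧ (adj a c ∧ not (adj b c))

  -- x a c d b x is a 5-cycle, except that cd need not be an edge
  Core : Fin k → Fin k → Fin k → Fin k → Bool
  Core a b c d = (Nbr a ∧ Nbr b) ∧ (Private a b c ∧ Private b a d)

  -- a < b selects one of the two orientations of the cycle
  Admissible : Fin k × Fin k × Fin k × Fin k → Bool
  Admissible (a , b , c , d) = does (a <? b) ∧ Core a b c d

  completed : Fin k × Fin k × Fin k × Fin k → List (Fin k)
  completed (a , b , c , d) = x ∷ a ∷ b ∷ c ∷ d ∷ []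

  Coded : Subset k → Set
  Coded = Encoded (fromList ∘ completed) Admissible

Completion₁ : Fin 5 → Set
Completion₁ i = ∃₂ λ a b → ∃₂ λ c d → a ≢ b × Core a b c d ≡ true × Core b a d c ≡ true ×
                Covers (i ∷ a ∷ b ∷ c ∷ d ∷ []) × Covers (i ∷ b ∷ a ∷ d ∷ c ∷ [])
  where open Around c5 i

c5-completion₁ : ∀ i → Completion₁ i
c5-completion₁ = from-yes (all? λ i → any? λ a → any? λ b → any? λ c → any? λ d →
  ¬? (a ≟ b) ×-dec (Around.Core c5 i a b c d Bool.≟ true) ×-dec (Around.Core c5 i b a d c Bool.≟ true) ×-dec
  covers? (i ∷ a ∷ b ∷ c ∷ d ∷ []) ×-dec covers? (i ∷ b ∷ a ∷ d ∷ c ∷ []))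

encode₁ : ∀ {n} (G : Graph n) {S} → InducesC5 G S → ∀ {x} → x ∈ S → Around.Coded (E G) x S
encode₁ G {S} C5 = encode
  where
  𝕖 : C5Embedding G S
  𝕖 = embedding C5
  open C5Embedding 𝕖
  open Embedded 𝕖
  transport : ∀ i a b c d → Around.Core (E G) (vertex i) (vertex a) (vertex b) (vertex c) (vertex d)
                          ≡ Around.Core c5 i a b c d
  transport i a b c d rewrite edge a c | edge b c | edge b d | edge a d =
    cong₂ _∧_ (cong₂ _∧_ (InClass-vertex (i ∷ []) (true ∷ []) a) (InClass-vertex (i ∷ []) (true ∷ []) b))
              (cong₂ _∧_ (cong (_∧ (c5 a c ∧ not (c5 b c))) (InClass-vertex (i ∷ []) (false ∷ []) c))
                         (cong (_∧ (c5 b d ∧ not (c5 a d))) (InClass-vertex (i ∷ []) (false ∷ []) d)))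
  oriented : ∀ i a b c d → vertex a < vertex b → Around.Core c5 i a b c d ≡ true →
             Covers (i ∷ a ∷ b ∷ c ∷ d ∷ []) → Around.Coded (E G) (vertex i) S
  oriented i a b c d va<vb core covers =
    (vertex a , vertex b , vertex c , vertex d) ,
    cong₂ _∧_ (dec-true (vertex a <? vertex b) va<vb) (trans (transport i a b c d) core) ,
    vertex-set (i ∷ a ∷ b ∷ c ∷ d ∷ []) covers
  complete : ∀ i → Completion₁ i → Around.Coded (E G) (vertex i) S
  complete i (a , b , c , d , a≢b , core , core′ , covers , covers′) with <-cmp (vertex a) (vertex b)
  ... | tri< va<vb _ _ = oriented i a b c d va<vb core covers
  ... | tri≈ _ va≡vb _ = contradiction (vertex-injective va≡vb) a≢b
  ... | tri> _ _ vb<va = oriented i b a d c vb<va core′ covers′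
  encode : ∀ {x} → x ∈ S → Around.Coded (E G) x S
  encode x∈S with located x∈S
  ... | i , refl = complete i (c5-completion₁ i)

module DoubleCounting {n} (G : Graph n) (x : Fin n) where
  open Around (E G) x

  nbr-𝟙 : ∀ v → 𝟙 (does (E G x v Bool.≟ true)) ≡ 𝟙 (Nbr v)
  nbr-𝟙 v with v ≟ x
  ... | yes refl rewrite irrfl G v = refl
  ... | no  _ with E G x v
  ...   | true  = refl
  ...   | false = refl

  nonNbr-𝟙 : ∀ v → 𝟙 (does (¬? (x ≟ v) ×-dec (E G x v Bool.≟ false))) ≡ 𝟙 (NonNbr v)
  nonNbr-𝟙 v with v ≟ x | x ≟ v
  ... | yes refl | yes _   = refl
  ... | yes refl | no x≢x  = contradiction refl x≢x
  ... | no v≢x   | yes x≡v = contradiction (sym x≡v) v≢x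
  ... | no  _    | no  _ with E G x v
  ...   | true  = refl
  ...   | false = refl

  N M : Fin n → ℕ
  N a = 𝟙 (Nbr a)
  M c = 𝟙 (NonNbr c)

  r b : ℕ
  r = classSize (true ∷ [])
  b = classSize (false ∷ [])

  nbrs≡r : nbrs G x ≡ r
  nbrs≡r = trans (length-filter-tabulate (λ v → E G x v Bool.≟ true) (λ v → v)) (sum-cong-≗ nbr-𝟙)

  nonNbrs≡b : nonNbrs G x ≡ b
  nonNbrs≡b =
    trans (length-filter-tabulate (λ v → ¬? (x ≟ v) ×-dec (E G x v Bool.≟ false)) (λ v → v)) (sum-cong-≗ nonNbr-𝟙)

  r+b+1≤n : r + b + 1 ≤ n
  r+b+1≤n = subst (λ s → s + 1 ≤ n) (cong (r +_) (+-identityʳ b))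
              (classSizes+length≤k ([] ∷ []) {(true ∷ []) ∷ (false ∷ []) ∷ []} (((λ ()) ∷ []) ∷ [] ∷ []))

  e ē : Fin n → Fin n → ℕ
  e a c = 𝟙 (E G a c)
  ē a c = 𝟙 (not (E G a c))

  P : Fin n → Fin n → ℕ
  P a a′ = ∑[ c < n ] 𝟙 (Private a a′ c)

  𝟙-Private : ∀ a a′ c → 𝟙 (Private a a′ c) ≡ M c * (e a c * ē a′ c)
  𝟙-Private a a′ c = trans (𝟙-∧ (NonNbr c) _) (cong (M c *_) (𝟙-∧ (E G a c) (not (E G a′ c))))

  P+P≤b : ∀ a a′ → P a a′ + P a′ a ≤ b
  P+P≤b a a′ = begin
    P a a′ + P a′ a
      ≡⟨ ∑-distrib-+ (λ c → 𝟙 (Private a a′ c)) (λ c → 𝟙 (Private a′ a c)) ⟨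
    ∑[ c < n ] (𝟙 (Private a a′ c) + 𝟙 (Private a′ a c))
      ≤⟨ sum-mono-≤ (λ c → 𝟙-private (NonNbr c) (E G a c) (E G a′ c)) ⟩
    b ∎
    where open ≤-Reasoning

  weight : Fin n → Fin n → ℕ
  weight a a′ = 𝟙 (does (a <? a′)) * (N a * N a′)

  Q : ℕ
  Q = ∑[ a < n ] ∑[ a′ < n ] (weight a a′ * (P a a′ * P a′ a))

  admissible-count : ∑[ a < n ] ∑[ a′ < n ] ∑[ c < n ] ∑[ d < n ] 𝟙 (Admissible (a , a′ , c , d)) ≡ Q
  admissible-count = sum-cong-≗ λ a → sum-cong-≗ λ a′ →
    trans (sum-cong-≗ λ c → sum-cong-≗ λ d → factor a a′ c d)
          (∑∑-scaled (weight a a′) (λ c → 𝟙 (Private a a′ c)) (λ d → 𝟙 (Private a′ a d)))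
    where
    factor : ∀ a a′ c d →
             𝟙 (Admissible (a , a′ , c , d)) ≡ weight a a′ * (𝟙 (Private a a′ c) * 𝟙 (Private a′ a d))
    factor a a′ c d = begin
      𝟙 (Admissible (a , a′ , c , d))
        ≡⟨ 𝟙-∧ (does (a <? a′)) _ ⟩
      𝟙 (does (a <? a′)) * 𝟙 (Core a a′ c d)
        ≡⟨ cong (𝟙 (does (a <? a′)) *_) (trans (𝟙-∧ (Nbr a ∧ Nbr a′) _)
             (cong₂ _*_ (𝟙-∧ (Nbr a) (Nbr a′)) (𝟙-∧ (Private a a′ c) (Private a′ a d)))) ⟩
      𝟙 (does (a <? a′)) * ((N a * N a′) * (𝟙 (Private a a′ c) * 𝟙 (Private a′ a d)))
        ≡⟨ *-assoc (𝟙 (does (a <? a′))) _ _ ⟨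
      weight a a′ * (𝟙 (Private a a′ c) * 𝟙 (Private a′ a d)) ∎
      where open ≡-Reasoning

  Pairs Triples : ℕ
  Pairs   = ∑[ a < n ] ∑[ a′ < n ] (weight a a′ * (P a a′ + P a′ a))
  Triples = ∑[ a < n ] ∑[ a′ < n ] (N a * N a′ * P a a′)

  4Q≤b*Pairs : 4 * Q ≤ b * Pairs
  4Q≤b*Pairs = begin
    4 * Q
      ≡⟨ ∑∑-distribˡ 4 (λ a a′ → weight a a′ * (P a a′ * P a′ a)) ⟨
    ∑[ a < n ] ∑[ a′ < n ] (4 * (weight a a′ * (P a a′ * P a′ a)))
      ≤⟨ sum-mono-≤ (λ a → sum-mono-≤ (pointwise a)) ⟩
    ∑[ a < n ] ∑[ a′ < n ] (b * (weight a a′ * (P a a′ + P a′ a)))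
      ≡⟨ ∑∑-distribˡ b (λ a a′ → weight a a′ * (P a a′ + P a′ a)) ⟩
    b * Pairs ∎
    where
    open ≤-Reasoning
    pointwise : ∀ a a′ → 4 * (weight a a′ * (P a a′ * P a′ a)) ≤ b * (weight a a′ * (P a a′ + P a′ a))
    pointwise a a′ = begin
      4 * (weight a a′ * (P a a′ * P a′ a)) ≡⟨ x∙yz≈y∙xz 4 (weight a a′) _ ⟩
      weight a a′ * (4 * (P a a′ * P a′ a)) ≤⟨ *-monoʳ-≤ (weight a a′) (am-gm₂-scaled (P a a′) (P a′ a) (P+P≤b a a′)) ⟩
      weight a a′ * (b * (P a a′ + P a′ a)) ≡⟨ x∙yz≈y∙xz (weight a a′) b _ ⟩
      b * (weight a a′ * (P a a′ + P a′ a)) ∎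

  Pairs≤Triples : Pairs ≤ Triples
  Pairs≤Triples = subst (_≤ Triples)
    (sum-cong-≗ λ a → sum-cong-≗ λ a′ → regroup (𝟙 (does (a <? a′))) (N a) (N a′) (P a a′) (P a′ a))
    (∑∑-symmetrise (λ a a′ → N a * N a′ * P a a′))
    where
    regroup : ∀ o p q u w → o * (p * q * u + q * p * w) ≡ o * (p * q) * (u + w)
    regroup = solve-∀

  t s : Fin n → ℕ
  t c = ∑[ a < n ] (N a * e a c)
  s c = ∑[ a < n ] (N a * ē a c)

  t+s≡r : ∀ c → t c + s c ≡ r
  t+s≡r c = trans (sym (∑-distrib-+ (λ a → N a * e a c) (λ a → N a * ē a c))) (sum-cong-≗ λ a → begin
    N a * e a c + N a * ē a c ≡⟨ *-distribˡ-+ (N a) (e a c) (ē a c) ⟨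
    N a * (e a c + ē a c)     ≡⟨ cong (N a *_) (𝟙-complement (E G a c)) ⟩
    N a * 1                   ≡⟨ *-identityʳ (N a) ⟩
    N a                       ∎)
    where open ≡-Reasoning

  Triples≡∑ts : Triples ≡ ∑[ c < n ] (M c * (t c * s c))
  Triples≡∑ts = begin
    Triples
      ≡⟨ sum-cong-≗ (λ a → sum-cong-≗ λ a′ →
           trans (*-distribˡ-sum (N a * N a′) (λ c → 𝟙 (Private a a′ c)))
                 (sum-cong-≗ λ c → cong (N a * N a′ *_) (𝟙-Private a a′ c))) ⟩
    ∑[ a < n ] ∑[ a′ < n ] ∑[ c < n ] term a a′ c
      ≡⟨ sum-cong-≗ (λ a → ∑-comm (term a)) ⟩
    ∑[ a < n ] ∑[ c < n ] ∑[ a′ < n ] term a a′ c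
      ≡⟨ ∑-comm (λ a c → ∑[ a′ < n ] term a a′ c) ⟩
    ∑[ c < n ] ∑[ a < n ] ∑[ a′ < n ] term a a′ c
      ≡⟨ sum-cong-≗ (λ c →
           trans (sum-cong-≗ λ a → sum-cong-≗ λ a′ → regroup (N a) (N a′) (M c) (e a c) (ē a′ c))
                 (∑∑-scaled (M c) (λ a → N a * e a c) (λ a′ → N a′ * ē a′ c))) ⟩
    ∑[ c < n ] (M c * (t c * s c)) ∎
    where
    open ≡-Reasoning
    term : Fin n → Fin n → Fin n → ℕ
    term a a′ c = N a * N a′ * (M c * (e a c * ē a′ c))
    regroup : ∀ p q m u w → p * q * (m * (u * w)) ≡ m * ((p * u) * (q * w))
    regroup = solve-∀

  4Triples≤b*r² : 4 * Triples ≤ b * (r * r)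
  4Triples≤b*r² = begin
    4 * Triples                          ≡⟨ cong (4 *_) Triples≡∑ts ⟩
    4 * ∑[ c < n ] (M c * (t c * s c))   ≡⟨ *-distribˡ-sum 4 (λ c → M c * (t c * s c)) ⟩
    ∑[ c < n ] (4 * (M c * (t c * s c))) ≡⟨ sum-cong-≗ (λ c → x∙yz≈y∙xz 4 (M c) (t c * s c)) ⟩
    ∑[ c < n ] (M c * (4 * (t c * s c))) ≤⟨ sum-mono-≤ (λ c → *-monoʳ-≤ (M c) (split c)) ⟩
    ∑[ c < n ] (M c * (r * r))           ≡⟨ *-distribʳ-sum (r * r) M ⟨
    b * (r * r)                          ∎
    where
    open ≤-Reasoning
    split : ∀ c → 4 * (t c * s c) ≤ r * r
    split c = subst (λ m → 4 * (t c * s c) ≤ m * m) (t+s≡r c) (am-gm₂ (t c) (s c))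

  16Q≤r²b² : 16 * Q ≤ r ^ 2 * b ^ 2
  16Q≤r²b² = begin
    16 * Q            ≡⟨ *-assoc 4 4 Q ⟩
    4 * (4 * Q)       ≤⟨ *-monoʳ-≤ 4 4Q≤b*Pairs ⟩
    4 * (b * Pairs)   ≡⟨ x∙yz≈y∙xz 4 b Pairs ⟩
    b * (4 * Pairs)   ≤⟨ *-monoʳ-≤ b (*-monoʳ-≤ 4 Pairs≤Triples) ⟩
    b * (4 * Triples) ≤⟨ *-monoʳ-≤ b 4Triples≤b*r² ⟩
    b * (b * (r * r)) ≡⟨ squares r b ⟩
    r ^ 2 * b ^ 2     ∎
    where
    open ≤-Reasoning
    squares : ∀ r b → b * (b * (r * r)) ≡ r * (r * 1) * (b * (b * 1))
    squares = solve-∀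

c5s-through-one : ∀ {n} (G : Graph n) (x : Fin n) →
  ((L : List (Subset n)) → C5Family G (λ S → x ∈ S) L → 16 * length L ≤ (nbrs G x ^ 2) * (nonNbrs G x ^ 2))
  × (16 * ((nbrs G x ^ 2) * (nonNbrs G x ^ 2)) ≤ (n ∸ 1) ^ 4)
c5s-through-one {n} G x rewrite DoubleCounting.nbrs≡r G x | DoubleCounting.nonNbrs≡b G x =
  count , am-gm₂-squared r b (m+n≤o⇒m≤o∸n (r + b) r+b+1≤n)
  where
  open Around (E G) x
  open DoubleCounting G x
  count : (L : List (Subset n)) → C5Family G (λ S → x ∈ S) L → 16 * length L ≤ r ^ 2 * b ^ 2
  count L (unique , members) = begin
    16 * length L
      ≤⟨ *-monoʳ-≤ 16 (length≤count 𝕂 _≟ˢ_ (fromList ∘ completed) Admissible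
                         unique (All.map (λ (x∈S , C5) → encode₁ G C5 x∈S) members)) ⟩
    16 * ∑[ a < n ] ∑[ a′ < n ] ∑[ c < n ] ∑[ d < n ] 𝟙 (Admissible (a , a′ , c , d))
      ≡⟨ cong (16 *_) admissible-count ⟩
    16 * Q
      ≤⟨ 16Q≤r²b² ⟩
    r ^ 2 * b ^ 2 ∎
    where
    open ≤-Reasoning
    𝕂 : Summable (Fin n × Fin n × Fin n × Fin n)
    𝕂 = fin-summable n ×-summable (fin-summable n ×-summable (fin-summable n ×-summable fin-summable n))

C5Family-weaken : ∀ {n} (G : Graph n) {P Q : Subset n → Set} → (∀ {S} → P S → Q S) →
                  ∀ {L} → C5Family G P L → C5Family G Q L
C5Family-weaken G P⇒Q (unique , members) = unique , All.map (λ (p , C5) → P⇒Q p , C5) members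

c5s-⊇-two-set : ∀ {n} (G : Graph n) (X : Subset n) → ∣ X ∣ ≡ 2 →
                (L : List (Subset n)) → C5Family G (λ S → X ⊆ S) L → 27 * length L ≤ (n ∸ 2) ^ 3
c5s-⊇-two-set G X ∣X∣≡2 L family with two-distinct X ∣X∣≡2
... | x , y , x∈X , y∈X , x≢y =
  c5s-through-two G x≢y (C5Family-weaken G (λ X⊆S → X⊆S x∈X , X⊆S y∈X) family)

c5s-⊇-three-set : ∀ {n} (G : Graph n) (X : Subset n) → ∣ X ∣ ≡ 3 →
                  (L : List (Subset n)) → C5Family G (λ S → X ⊆ S) L → 4 * length L ≤ (n ∸ 3) ^ 2
c5s-⊇-three-set G X ∣X∣≡3 L family with three-distinct X ∣X∣≡3
... | x , y , z , (x∈X , y∈X , z∈X) , (x≢y , y≢z , x≢z) =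
  c5s-through-three G x≢y y≢z x≢z (C5Family-weaken G (λ X⊆S → X⊆S x∈X , X⊆S y∈X , X⊆S z∈X) family)

lemma3 : (n : ℕ) (G : Graph n) →
  ((x : Fin n) →
    ((L : List (Subset n)) → C5Family G (λ S → x ∈ S) L →
      16 * length L ≤ (nbrs G x ^ 2) * (nonNbrs G x ^ 2))
    × (16 * ((nbrs G x ^ 2) * (nonNbrs G x ^ 2)) ≤ (n ∸ 1) ^ 4))
  × ((X : Subset n) → ∣ X ∣ ≡ 2 → (L : List (Subset n)) → C5Family G (λ S → X ⊆ S) L →
      27 * length L ≤ (n ∸ 2) ^ 3)
  × ((X : Subset n) → ∣ X ∣ ≡ 3 → (L : List (Subset n)) → C5Family G (λ S → X ⊆ S) L →
      4 * length L ≤ (n ∸ 3) ^ 2)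
lemma3 n G = c5s-through-one G , c5s-⊇-two-set G , c5s-⊇-three-set G
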